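{- Let $\mathcal{M}=(W,(\Sigma_a)_{a\in\mathcal{A}},V)$ be an inquisitive S5 structure and let $\rho:W\to C:=W/{\sim}$ map each world to its bisimulation class, lifted by $\rho(s):=\{\rho(v):v\in s\}$ for $s\subseteq W$ and $\rho(\Pi):=\{\rho(s):s\in\Pi\}$ for $\Pi\subseteq\wp(W)$. Then for all worlds $w,w'\in W$ and all $a\in\mathcal{A}$: if $\mathcal{M},w\sim\mathcal{M},w'$ then $\rho(\Sigma_a(w))=\rho(\Sigma_a(w'))$. Moreover, if $\mathcal{M}$ is simple and $\mathcal{M},w\sim\mathcal{M},w'$, then there is a unique isomorphism between the Boolean algebra of $\rho$-saturated subsets of $[w]_a$ and that of $[w']_a$ which preserves the colouring (i.e. relates $s$ and $s'$ exactly when $\rho(s)=\rho(s')$), and this isomorphism maps members of $\Sigma_a(w)$ exactly onto members of $\Sigma_a(w')$.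
   Context: An inquisitive S5 structure over atoms $\mathcal{P}$ and agents $\mathcal{A}$ is $\mathcal{M}=(W,(\Sigma_a)_{a\in\mathcal{A}},V)$ with $V:\mathcal{P}\to\wp(W)$ and each $\Sigma_a(w)$ a non-empty, subset-closed family of subsets of $W$, such that, with $\sigma_a(w):=\bigcup\Sigma_a(w)$: $w\in\sigma_a(w)$, and $v\in\sigma_a(w)$ implies $\Sigma_a(v)=\Sigma_a(w)$. Then $R_a=\{(w,v):v\in\sigma_a(w)\}$ is an equivalence relation whose class $[w]_a=\sigma_a(w)$ carries the constant value $\Sigma_a(w)$. Bisimilarity $\sim$ of worlds: in the game, from a world-position $(w,w')$ player I chooses an agent $a$ and a state in $\Sigma_a(w)$ or $\Sigma_a(w')$ and II replies with a state in the other; from a state-position $(s,s')$ I picks a world in one of the states and II replies with a world in the other. Stuck players lose; II loses at world-positions disagreeing on an atom; otherwise (including infinite plays) II wins; $w\sim w'$ iff II has a winning strategy from $(w,w')$. A subset $s\subseteq[w]_a$ is $\rho$-saturated if $s=\{v\in[w]_a:\rho(v)\in\rho(s)\}$. $\mathcal{M}$ is simple if for every $a$ and $w$, $\Sigma_a(w)$ is the downward closure (under subsets) of a collection of $\rho$-saturated subsets of $[w]_a$. -}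

module Defs where

open import Level using (Level; 0ℓ)
open import Data.Product using (Σ; ∃; ∃₂; _×_; _,_; proj₁; proj₂)
open import Data.Sum using (_⊎_)
open import Data.Empty using (⊥)
open import Relation.Nullary using (¬_)

Subset : Set → Set₁
Subset X = X → Set

_⊆_ : ∀ {X : Set} {ℓ₁ ℓ₂} → (X → Set ℓ₁) → (X → Set ℓ₂) → Set (ℓ₁ Level.⊔ ℓ₂)
s ⊆ t = ∀ x → s x → t x

_≐_ : ∀ {X : Set} {ℓ₁ ℓ₂} → (X → Set ℓ₁) → (X → Set ℓ₂) → Set (ℓ₁ Level.⊔ ℓ₂)
s ≐ t = (s ⊆ t) × (t ⊆ s)

_⇔_ : ∀ {ℓ₁ ℓ₂} → Set ℓ₁ → Set ℓ₂ → Set (ℓ₁ Level.⊔ ℓ₂)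
A ⇔ B = (A → B) × (B → A)

record InqS5 (P A W : Set) : Set₂ where
  field
    V            : P → Subset W
    Sig          : A → W → Subset W → Set
    nonEmpty     : ∀ a w → ∃ λ (s : Subset W) → Sig a w s
    subsetClosed : ∀ a w (s t : Subset W) → t ⊆ s → Sig a w s → Sig a w t

  σ : A → W → W → Set₁
  σ a w v = ∃ λ (s : Subset W) → Sig a w s × s v

  field
    reflexive : ∀ a w → σ a w w
    constant  : ∀ a w v → σ a w v → ∀ (s : Subset W) → Sig a v s ⇔ Sig a w s

module _ {P A W : Set} (M : InqS5 P A W) where
  open InqS5 M

  -- A set of world-positions Z and state-positions Z' from which player II
  -- can always answer player I's moves and never loses (a positional winning
  -- strategy/invariant for II in the bisimulation game).
  record IsWinning (Z : W → W → Set) (Z' : Subset W → Subset W → Set) : Set₁ where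
    field
      atoms  : ∀ {w w'} → Z w w' → ∀ p → V p w ⇔ V p w'
      forth  : ∀ {w w'} → Z w w' → ∀ a (s : Subset W) → Sig a w s →
               ∃ λ (s' : Subset W) → Sig a w' s' × Z' s s'
      back   : ∀ {w w'} → Z w w' → ∀ a (s' : Subset W) → Sig a w' s' →
               ∃ λ (s : Subset W) → Sig a w s × Z' s s'
      sforth : ∀ {s s'} → Z' s s' → ∀ v → s v → ∃ λ v' → s' v' × Z v v'
      sback  : ∀ {s s'} → Z' s s' → ∀ v' → s' v' → ∃ λ v → s v × Z v v'

  _∼_ : W → W → Set₁
  w ∼ w' = Σ (W → W → Set) λ Z → Σ (Subset W → Subset W → Set) λ Z' →
             IsWinning Z Z' × Z w w'

  -- ρ(s) = ρ(t), with ρ the quotient map W → W/∼ (quotient rendered via ∼).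
  ρ≡ : Subset W → Subset W → Set₁
  ρ≡ s t = (∀ v → s v → ∃ λ v' → t v' × (v ∼ v'))
         × (∀ v' → t v' → ∃ λ v → s v × (v ∼ v'))

  ρΠ≡ : (Subset W → Set) → (Subset W → Set) → Set₁
  ρΠ≡ Π Π' = (∀ s → Π s → ∃ λ s' → Π' s' × ρ≡ s s')
           × (∀ s' → Π' s' → ∃ λ s → Π s × ρ≡ s s')

  Saturated : A → W → Subset W → Set₁
  Saturated a w s = (s ⊆ σ a w)
                  × (∀ v → σ a w v → (∃ λ u → s u × (v ∼ u)) → s v)

  IsSimple : Set₂
  IsSimple = ∀ a w → ∃ λ (G : Subset W → Set₁) →
               (∀ s → G s → Saturated a w s)
             × (∀ s → Sig a w s ⇔ (∃ λ t → G t × (s ⊆ t)))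

  Sat : A → W → Set₁
  Sat a w = Σ (Subset W) (Saturated a w)

  _∪_ _∩_ : Subset W → Subset W → Subset W
  (s ∪ t) v = s v ⊎ t v
  (s ∩ t) v = s v × t v

  compl : A → W → Subset W → W → Set₁
  compl a w s v = σ a w v × ¬ s v

  empty : Subset W
  empty _ = ⊥

  record BAIso (a : A) (w w' : W) : Set₁ where
    field
      to      : Sat a w → Sat a w'
      from    : Sat a w' → Sat a w
      to-cong   : ∀ s t → proj₁ s ≐ proj₁ t → proj₁ (to s) ≐ proj₁ (to t)
      from-cong : ∀ s t → proj₁ s ≐ proj₁ t → proj₁ (from s) ≐ proj₁ (from t)
      from-to : ∀ s → proj₁ (from (to s)) ≐ proj₁ s
      to-from : ∀ s → proj₁ (to (from s)) ≐ proj₁ s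
      pres-∪  : ∀ s t u → proj₁ u ≐ (proj₁ s ∪ proj₁ t) →
                proj₁ (to u) ≐ (proj₁ (to s) ∪ proj₁ (to t))
      pres-∩  : ∀ s t u → proj₁ u ≐ (proj₁ s ∩ proj₁ t) →
                proj₁ (to u) ≐ (proj₁ (to s) ∩ proj₁ (to t))
      pres-¬  : ∀ s u → proj₁ u ≐ compl a w (proj₁ s) →
                proj₁ (to u) ≐ compl a w' (proj₁ (to s))
      pres-⊥  : ∀ s → proj₁ s ≐ empty → proj₁ (to s) ≐ empty
      pres-⊤  : ∀ s → proj₁ s ≐ σ a w → proj₁ (to s) ≐ σ a w'

  ColourPreserving : ∀ {a w w'} → BAIso a w w' → Set₁
  ColourPreserving {a} {w} {w'} f = ∀ (s : Sat a w) (s' : Sat a w') → (proj₁ (BAIso.to f s) ≐ proj₁ s') ⇔ ρ≡ (proj₁ s) (proj₁ s')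

{-# OPTIONS --safe #-}
module Submission where

-- Bisimilarity is an equivalence relation, and player II's answers in the
-- game turn every state of Σ_a(w) into a state of Σ_a(w') carrying the same
-- colours, which is the first part.  Moreover every world of [w]_a is
-- bisimilar to a world of [w']_a and conversely, so the map
-- s ↦ {v' ∈ [w']_a : ρ(v') ∈ ρ(s)} sends ρ-saturated sets to ρ-saturated
-- sets, is inverted by the same construction from w' back to w, and commutes
-- with the Boolean operations.  A ρ-saturated set is determined by its
-- colours, which makes this map colour preserving and forces every colour
-- preserving isomorphism to coincide with it.  In a simple structure each
-- state of Σ_a(w) is colour-matched by a state of Σ_a(w'), which lies in a
-- saturated member of Σ_a(w'); that member then contains the image of the
-- state.

open import Defs
open import Level using (_⊔_)
open import Data.Product using (Σ; ∃; _×_; _,_; proj₁; proj₂; swap)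
open import Data.Sum using (inj₁; inj₂; [_,_]) renaming (map to ⊎-map)
open import Function using (flip)
open import Relation.Binary.PropositionalEquality using (refl)
open import Relation.Unary using (｛_｝)

≐-refl : ∀ {X : Set} {ℓ} {s : X → Set ℓ} → s ≐ s
≐-refl = (λ _ x → x) , (λ _ x → x)

_⨾_ : ∀ {X : Set} {ℓ₁ ℓ₂} → (X → X → Set ℓ₁) → (X → X → Set ℓ₂) → X → X → Set (ℓ₁ ⊔ ℓ₂)
(R ⨾ S) x z = ∃ λ y → R x y × S y z

EgliMilner : ∀ {X : Set} {ℓ} → (X → X → Set ℓ) → Subset X → Subset X → Set ℓ
EgliMilner R s t = (∀ v → s v → ∃ λ v' → t v' × R v v')
                 × (∀ v' → t v' → ∃ λ v → s v × R v v')

module _ {X : Set} {s t : Subset X} where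

  EgliMilner-mono : ∀ {ℓ₁ ℓ₂} {R : X → X → Set ℓ₁} {S : X → X → Set ℓ₂} →
                    (∀ {x y} → R x y → S x y) → EgliMilner R s t → EgliMilner S s t
  EgliMilner-mono R⇒S (fwd , bwd) =
      (λ v sv → let (v' , tv' , Rvv') = fwd v sv in v' , tv' , R⇒S Rvv')
    , (λ v' tv' → let (v , sv , Rvv') = bwd v' tv' in v , sv , R⇒S Rvv')

  EgliMilner-sym : ∀ {ℓ} {R : X → X → Set ℓ} →
                   (∀ {x y} → R x y → R y x) → EgliMilner R s t → EgliMilner R t s
  EgliMilner-sym R-sym (fwd , bwd) =
      (λ v' tv' → let (v , sv , Rvv') = bwd v' tv' in v , sv , R-sym Rvv')
    , (λ v sv → let (v' , tv' , Rvv') = fwd v sv in v' , tv' , R-sym Rvv')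

  EgliMilner-compose : ∀ {ℓ₁ ℓ₂} {R : X → X → Set ℓ₁} {S : X → X → Set ℓ₂} {u : Subset X} →
                       EgliMilner R s t → EgliMilner S t u → EgliMilner (R ⨾ S) s u
  EgliMilner-compose (fwdR , bwdR) (fwdS , bwdS) =
      (λ v sv → let (v' , tv' , Rvv') = fwdR v sv
                    (v'' , uv'' , Sv'v'') = fwdS v' tv'
                in v'' , uv'' , (v' , Rvv' , Sv'v''))
    , (λ v'' uv'' → let (v' , tv' , Sv'v'') = bwdS v'' uv''
                        (v , sv , Rvv') = bwdR v' tv'
                    in v , sv , (v' , Rvv' , Sv'v''))

module _ {P A W : Set} (M : InqS5 P A W) where
  open InqS5 M

  infix 4 _≈_
  _≈_ : W → W → Set₁
  _≈_ = _∼_ M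

  winning⇒∼ : ∀ {Z Z'} → IsWinning M Z Z' → ∀ {v v'} → Z v v' → v ≈ v'
  winning⇒∼ win Zvv' = _ , _ , win , Zvv'

  winning-EgliMilner : ∀ {Z Z'} → IsWinning M Z Z' →
                       ∀ {s s'} → Z' s s' → EgliMilner Z s s'
  winning-EgliMilner win Z'ss' = IsWinning.sforth win Z'ss' , IsWinning.sback win Z'ss'

  ∼-sym : ∀ {w w'} → w ≈ w' → w' ≈ w
  ∼-sym (Z , Z' , win , z) = flip Z , flip Z' , flipped , z
    where
    open IsWinning win
    flipped : IsWinning M (flip Z) (flip Z')
    flipped = record
      { atoms = λ Zww' p → swap (atoms Zww' p)
      ; forth = back ; back = forth ; sforth = sback ; sback = sforth }

  -- The composite of Z₁' and Z₂' would quantify over Subset W and leave Set,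
  -- so the state relation is the Egli–Milner lifting of the world relation.
  ∼-trans : ∀ {w w' w''} → w ≈ w' → w' ≈ w'' → w ≈ w''
  ∼-trans (Z₁ , Z₁' , win₁ , z₁) (Z₂ , Z₂' , win₂ , z₂) =
    (Z₁ ⨾ Z₂) , EgliMilner (Z₁ ⨾ Z₂) , composite , (_ , z₁ , z₂)
    where
    module W₁ = IsWinning win₁
    module W₂ = IsWinning win₂
    lift : ∀ {s t u} → Z₁' s t → Z₂' t u → EgliMilner (Z₁ ⨾ Z₂) s u
    lift Z₁'st Z₂'tu =
      EgliMilner-compose (winning-EgliMilner win₁ Z₁'st) (winning-EgliMilner win₂ Z₂'tu)
    composite : IsWinning M (Z₁ ⨾ Z₂) (EgliMilner (Z₁ ⨾ Z₂))
    composite = record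
      { atoms = λ (_ , z₁ , z₂) p →
          let (to₁ , from₁) = W₁.atoms z₁ p ; (to₂ , from₂) = W₂.atoms z₂ p
          in (λ x → to₂ (to₁ x)) , (λ x → from₁ (from₂ x))
      ; forth = λ (_ , z₁ , z₂) a s Sig-s →
          let (t , Sig-t , Z₁'st) = W₁.forth z₁ a s Sig-s
              (u , Sig-u , Z₂'tu) = W₂.forth z₂ a t Sig-t
          in u , Sig-u , lift Z₁'st Z₂'tu
      ; back = λ (_ , z₁ , z₂) a u Sig-u →
          let (t , Sig-t , Z₂'tu) = W₂.back z₂ a u Sig-u
              (s , Sig-s , Z₁'st) = W₁.back z₁ a t Sig-t
          in s , Sig-s , lift Z₁'st Z₂'tu
      ; sforth = proj₁ ; sback = proj₂ }

  ρ≡-sym : ∀ {s t} → ρ≡ M s t → ρ≡ M t s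
  ρ≡-sym = EgliMilner-sym ∼-sym

  σ⇒Sig-singleton : ∀ {a w v} → σ a w v → Sig a w ｛ v ｝
  σ⇒Sig-singleton {a} {w} {v} (t , Sig-t , tv) = subsetClosed a w t ｛ v ｝ (λ { _ refl → tv }) Sig-t

  ∼-forth : ∀ {a w w'} → w ≈ w' → ∀ s → Sig a w s → ∃ λ s' → Sig a w' s' × ρ≡ M s s'
  ∼-forth {a} (Z , Z' , win , z) s Sig-s =
    let (s' , Sig-s' , Z'ss') = IsWinning.forth win z a s Sig-s
    in s' , Sig-s' , EgliMilner-mono (winning⇒∼ win) (winning-EgliMilner win Z'ss')

  Sig-ρΠ≡ : ∀ {a w w'} → w ≈ w' → ρΠ≡ M (Sig a w) (Sig a w')
  Sig-ρΠ≡ w≈w' =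
      ∼-forth w≈w'
    , λ s' Sig-s' → let (s , Sig-s , s'≡s) = ∼-forth (∼-sym w≈w') s' Sig-s'
                    in s , Sig-s , ρ≡-sym s'≡s

  saturated-superset : IsSimple M → ∀ {a w s} → Sig a w s →
                       ∃ λ h → Saturated M a w h × s ⊆ h × Sig a w h
  saturated-superset simple {a} {w} {s} Sig-s =
    let (G , G-saturated , Sig⇔below-G) = simple a w
        (h , Gh , s⊆h) = proj₁ (Sig⇔below-G s) Sig-s
    in h , G-saturated h Gh , s⊆h , proj₂ (Sig⇔below-G h) (h , Gh , λ _ hx → hx)

  Saturation : A → W → Subset W → W → Set₁
  Saturation a w' s v' = σ a w' v' × ∃ λ u → s u × u ≈ v'

  ≐Saturation⇒Saturated : ∀ {a w' s} {t : Subset W} → t ≐ Saturation a w' s → Saturated M a w' t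
  ≐Saturation⇒Saturated (t⊆ , ⊆t) =
      (λ v' tv' → proj₁ (t⊆ v' tv'))
    , λ v' σv' (u' , tu' , v'≈u') →
        let (_ , u , su , u≈u') = t⊆ u' tu'
        in ⊆t v' (σv' , u , su , ∼-trans u≈u' (∼-sym v'≈u'))

  IsTransfer : ∀ a w w' → (Sat M a w → Sat M a w') → Set₁
  IsTransfer a w w' F = ∀ s → proj₁ (F s) ≐ Saturation a w' (proj₁ s)

  module _ (a : A) {w w' : W} {Z Z'} (win : IsWinning M Z Z') (z : Z w w') where

    Z-coverʳ : ∀ v' → σ a w' v' → ∃ λ v → σ a w v × Z v v'
    Z-coverʳ v' σv' =
      let (t , Sig-t , Z't｛v'｝) = IsWinning.back win z a ｛ v' ｝ (σ⇒Sig-singleton σv')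
          (v , tv , Zvv') = IsWinning.sback win Z't｛v'｝ v' refl
      in v , (t , Sig-t , tv) , Zvv'

    -- Saturation a w' s lives in Set₁, but a Subset W must be Set-valued:
    -- here σ a w' is witnessed by a singleton state and ≈ by Z.
    Saturation₀ : Subset W → Subset W
    Saturation₀ s v' = Sig a w' ｛ v' ｝ × ∃ λ u → s u × Z u v'

    Saturation₀≐Saturation : ∀ {s} → Saturated M a w s → Saturation₀ s ≐ Saturation a w' s
    Saturation₀≐Saturation (_ , s-closed) =
        (λ v' (Sig-｛v'｝ , u , su , Zuv') → (｛ v' ｝ , Sig-｛v'｝ , refl) , u , su , winning⇒∼ win Zuv')
      , λ v' (σv' , u , su , u≈v') →
          let (x , σx , Zxv') = Z-coverʳ v' σv'
              sx = s-closed x σx (u , su , ∼-trans (winning⇒∼ win Zxv') (∼-sym u≈v'))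
          in σ⇒Sig-singleton σv' , x , sx , Zxv'

  transfer : ∀ a {w w'} → w ≈ w' → Σ (Sat M a w → Sat M a w') (IsTransfer a w w')
  transfer a (_ , _ , win , z) =
      (λ (s , s-saturated) → Saturation₀ a win z s
                           , ≐Saturation⇒Saturated (Saturation₀≐Saturation a win z s-saturated))
    , λ (s , s-saturated) → Saturation₀≐Saturation a win z s-saturated

  ∼-coverʳ : ∀ {a w w'} → w ≈ w' → ∀ v' → σ a w' v' → ∃ λ v → σ a w v × v ≈ v'
  ∼-coverʳ {a} (_ , _ , win , z) v' σv' =
    let (v , σv , Zvv') = Z-coverʳ a win z v' σv' in v , σv , winning⇒∼ win Zvv'

  ∼-coverˡ : ∀ {a w w'} → w ≈ w' → ∀ v → σ a w v → ∃ λ v' → σ a w' v' × v ≈ v'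
  ∼-coverˡ w≈w' v σv =
    let (v' , σv' , v'≈v) = ∼-coverʳ (∼-sym w≈w') v σv in v' , σv' , ∼-sym v'≈v

  module Transfer {a : A} {w w' : W} (w≈w' : w ≈ w')
                  {F : Sat M a w → Sat M a w'} (isF : IsTransfer a w w' F) where

    into : ∀ s → proj₁ (F s) ⊆ Saturation a w' (proj₁ s)
    into s = proj₁ (isF s)

    onto : ∀ s → Saturation a w' (proj₁ s) ⊆ proj₁ (F s)
    onto s = proj₂ (isF s)

    mono : ∀ s t → proj₁ s ⊆ proj₁ t → proj₁ (F s) ⊆ proj₁ (F t)
    mono s t s⊆t v' Fsv' =
      let (σv' , u , su , u≈v') = into s v' Fsv' in onto t v' (σv' , u , s⊆t u su , u≈v')

    cong : ∀ s t → proj₁ s ≐ proj₁ t → proj₁ (F s) ≐ proj₁ (F t)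
    cong s t (s⊆t , t⊆s) = mono s t s⊆t , mono t s t⊆s

    reflects : ∀ s {v' x} → proj₁ (F s) v' → σ a w x → x ≈ v' → proj₁ s x
    reflects (_ , _ , s-closed) {v'} {x} Fsv' σx x≈v' =
      let (_ , u , su , u≈v') = into _ v' Fsv'
      in s-closed x σx (u , su , ∼-trans x≈v' (∼-sym u≈v'))

    ⊆-saturated : ∀ s (h : Subset W) → Saturated M a w' h →
                  (∀ u → proj₁ s u → ∃ λ u' → h u' × u ≈ u') → proj₁ (F s) ⊆ h
    ⊆-saturated s h (_ , h-closed) s→h v' Fsv' =
      let (σv' , u , su , u≈v') = into s v' Fsv'
          (u' , hu' , u≈u') = s→h u su
      in h-closed v' σv' (u' , hu' , ∼-trans (∼-sym u≈v') u≈u')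

    colourPreserving : ∀ s (s' : Sat M a w') → (proj₁ (F s) ≐ proj₁ s') ⇔ ρ≡ M (proj₁ s) (proj₁ s')
    colourPreserving s (s' , s'⊆σ , s'-closed) =
        (λ (Fs⊆s' , s'⊆Fs) →
            (λ v sv → let (v' , σv' , v≈v') = ∼-coverˡ w≈w' v (proj₁ (proj₂ s) v sv)
                      in v' , Fs⊆s' v' (onto s v' (σv' , v , sv , v≈v')) , v≈v')
          , (λ v' s'v' → proj₂ (into s v' (s'⊆Fs v' s'v'))))
      , (λ (fwd , bwd) →
            ⊆-saturated s s' (s'⊆σ , s'-closed) fwd
          , (λ v' s'v' → let (u , su , u≈v') = bwd v' s'v'
                         in onto s v' (s'⊆σ v' s'v' , u , su , u≈v')))

    ∪-homo : ∀ s t u → proj₁ u ≐ (_∪_ M (proj₁ s) (proj₁ t)) →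
             proj₁ (F u) ≐ (_∪_ M (proj₁ (F s)) (proj₁ (F t)))
    ∪-homo s t u (u⊆s∪t , s∪t⊆u) =
        (λ v' Fuv' →
          let (σv' , x , ux , x≈v') = into u v' Fuv'
          in ⊎-map (λ sx → onto s v' (σv' , x , sx , x≈v'))
                   (λ tx → onto t v' (σv' , x , tx , x≈v'))
                   (u⊆s∪t x ux))
      , λ v' → [ mono s u (λ x sx → s∪t⊆u x (inj₁ sx)) v'
               , mono t u (λ x tx → s∪t⊆u x (inj₂ tx)) v' ]

    ∩-homo : ∀ s t u → proj₁ u ≐ (_∩_ M (proj₁ s) (proj₁ t)) →
             proj₁ (F u) ≐ (_∩_ M (proj₁ (F s)) (proj₁ (F t)))
    ∩-homo s t u (u⊆s∩t , s∩t⊆u) =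
        (λ v' Fuv' → mono u s (λ x ux → proj₁ (u⊆s∩t x ux)) v' Fuv'
                   , mono u t (λ x ux → proj₂ (u⊆s∩t x ux)) v' Fuv')
      , λ v' (Fsv' , Ftv') →
          let (σv' , x , sx , x≈v') = into s v' Fsv'
              tx = reflects t Ftv' (proj₁ (proj₂ s) x sx) x≈v'
          in onto u v' (σv' , x , s∩t⊆u x (sx , tx) , x≈v')

    compl-homo : ∀ s u → proj₁ u ≐ compl M a w (proj₁ s) →
                 proj₁ (F u) ≐ compl M a w' (proj₁ (F s))
    compl-homo s u (u⊆∁s , ∁s⊆u) =
        (λ v' Fuv' →
          let (σv' , x , ux , x≈v') = into u v' Fuv'
              (σx , x∉s) = u⊆∁s x ux
          in σv' , λ Fsv' → x∉s (reflects s Fsv' σx x≈v'))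
      , λ v' (σv' , v'∉Fs) →
          let (x , σx , x≈v') = ∼-coverʳ w≈w' v' σv'
              x∉s = λ sx → v'∉Fs (onto s v' (σv' , x , sx , x≈v'))
          in onto u v' (σv' , x , ∁s⊆u x (σx , x∉s) , x≈v')

    empty-homo : ∀ s → proj₁ s ≐ empty M → proj₁ (F s) ≐ empty M
    empty-homo s (s⊆∅ , _) =
      (λ v' Fsv' → let (_ , x , sx , _) = into s v' Fsv' in s⊆∅ x sx) , λ _ ()

    full-homo : ∀ s → proj₁ s ≐ σ a w → proj₁ (F s) ≐ σ a w'
    full-homo s (_ , σ⊆s) =
        (λ v' Fsv' → proj₁ (into s v' Fsv'))
      , λ v' σv' → let (x , σx , x≈v') = ∼-coverʳ w≈w' v' σv'
                   in onto s v' (σv' , x , σ⊆s x σx , x≈v')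

    Sig-preserving : IsSimple M → ∀ s → Sig a w (proj₁ s) → Sig a w' (proj₁ (F s))
    Sig-preserving simple s Sig-s =
      let (s' , Sig-s' , s≡s') = ∼-forth w≈w' (proj₁ s) Sig-s
          (h , h-saturated , s'⊆h , Sig-h) = saturated-superset simple Sig-s'
          s→h = λ u su → let (u' , s'u' , u≈u') = proj₁ s≡s' u su in u' , s'⊆h u' s'u' , u≈u'
      in subsetClosed a w' h (proj₁ (F s)) (⊆-saturated s h h-saturated s→h) Sig-h

  transfer-inverse : ∀ {a w w'} → w ≈ w' →
                     ∀ {F K} → IsTransfer a w w' F → IsTransfer a w' w K →
                     ∀ s → proj₁ (K (F s)) ≐ proj₁ s
  transfer-inverse {a} w≈w' {F} {K} isF isK s =
    proj₂ (K.colourPreserving (F s) s) (ρ≡-sym (proj₁ (F.colourPreserving s (F s)) ≐-refl))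
    where
    module F = Transfer {a} w≈w' {F} isF
    module K = Transfer {a} (∼-sym w≈w') {K} isK

  ColourPreserving-unique : ∀ {a w w'} (f g : BAIso M a w w') →
                            ColourPreserving M f → ColourPreserving M g →
                            ∀ s → proj₁ (BAIso.to g s) ≐ proj₁ (BAIso.to f s)
  ColourPreserving-unique f g f-colour g-colour s =
    swap (proj₂ (f-colour s (BAIso.to g s)) (proj₁ (g-colour s (BAIso.to g s)) ≐-refl))

  module TransferIso (a : A) {w w' : W} (w≈w' : w ≈ w') where
    private
      F : Sat M a w → Sat M a w'
      F = proj₁ (transfer a w≈w')
      isF : IsTransfer a w w' F
      isF = proj₂ (transfer a w≈w')
      K : Sat M a w' → Sat M a w
      K = proj₁ (transfer a (∼-sym w≈w'))
      isK : IsTransfer a w' w K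
      isK = proj₂ (transfer a (∼-sym w≈w'))
      module F = Transfer {a} w≈w' {F} isF
      module K = Transfer {a} (∼-sym w≈w') {K} isK

    iso : BAIso M a w w'
    iso = record
      { to = F ; from = K
      ; to-cong = F.cong ; from-cong = K.cong
      ; from-to = transfer-inverse {a} w≈w' {F} {K} isF isK
      ; to-from = transfer-inverse {a} (∼-sym w≈w') {K} {F} isK isF
      ; pres-∪ = F.∪-homo ; pres-∩ = F.∩-homo ; pres-¬ = F.compl-homo
      ; pres-⊥ = F.empty-homo ; pres-⊤ = F.full-homo }

    colourPreserving : ColourPreserving M iso
    colourPreserving = F.colourPreserving

    Sig-⇔ : IsSimple M → ∀ s → Sig a w (proj₁ s) ⇔ Sig a w' (proj₁ (F s))
    Sig-⇔ simple s =
        F.Sig-preserving simple s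
      , λ Sig-Fs → subsetClosed a w (proj₁ (K (F s))) (proj₁ s) (proj₂ (transfer-inverse {a} w≈w' {F} {K} isF isK s))
                                 (K.Sig-preserving simple (F s) Sig-Fs)

lemma9p9 : ∀ {P A W : Set} (M : InqS5 P A W) →
    (∀ a w w' → _∼_ M w w' → ρΠ≡ M (InqS5.Sig M a w) (InqS5.Sig M a w'))
  × (IsSimple M → ∀ a w w' → _∼_ M w w' →
      ∃ λ (f : BAIso M a w w') →
          ColourPreserving M f
        × (∀ (g : BAIso M a w w') → ColourPreserving M g →
             ∀ s → proj₁ (BAIso.to g s) ≐ proj₁ (BAIso.to f s))
        × (∀ s → InqS5.Sig M a w (proj₁ s) ⇔ InqS5.Sig M a w' (proj₁ (BAIso.to f s))))
lemma9p9 M =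
    (λ a w w' → Sig-ρΠ≡ M)
  , λ simple a w w' w≈w' →
      let open TransferIso M a w≈w'
      in iso
       , colourPreserving
       , (λ g g-colour → ColourPreserving-unique M iso g colourPreserving g-colour)
       , Sig-⇔ simple
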